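{- Let $G$ and $H$ be vertex-disjoint strongly connected graphs, let $v\in V(G)$ and $w\in V(H)$, and let $(G\cup H)/vw$ be the graph obtained from $G\cup H$ by identifying $v$ and $w$. If $w$ is a simple vertex of $H$, then $$\mathcal{K}(G\cup H)\simeq\mathcal{K}((G\cup H)/vw)\oplus\mathbf{Z}\quad\text{and}\quad K(G\cup H)\simeq K((G\cup H)/vw).$$
   Context: A graph is a finite directed multigraph. For $G=(V,E)$, $A$ is the $V\times V$ matrix with $A_{vw}$ the number of directed edges from $v$ to $w$, $\Delta$ is diagonal with $\Delta_{vv}=\sum_wA_{vw}$, $Q=\Delta-A$, $\dagger$ denotes transpose, $\mathcal{K}(G)=\mathbf{Z}^V/Q^{\dagger}\mathbf{Z}^V$ and $K(G)$ is its torsion subgroup. For strongly connected $G$, the activity vector $\mathbf{h}$ is the unique vector with positive integer entries, $\gcd$ of entries equal to $1$, and $Q^{\dagger}\mathbf{h}=\mathbf{0}$; a vertex $v$ is simple if $h(v)=1$. -}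

module Defs where

open import Level using (0ℓ)
open import Data.Nat as ℕ using (ℕ; zero; suc)
open import Data.Nat.GCD using (gcd)
open import Data.Integer as ℤ using (ℤ; +_; 0ℤ; -1ℤ; _+_; _*_; -_; _-_)
open import Data.Integer.Properties as ℤP using (+-*-commutativeRing)
open import Data.Integer.Tactic.RingSolver using (solve-∀)
open import Data.Fin as Fin using (Fin; splitAt; _↑ˡ_; _↑ʳ_; punchOut)
open import Data.Fin.Properties using (_≟_)
open import Data.Sum using (inj₁; inj₂)
open import Data.Product using (Σ; Σ-syntax; ∃; ∃-syntax; _×_; _,_; proj₁; proj₂)
open import Data.Bool using (if_then_else_; _∧_)
open import Function using (_∘_)
open import Relation.Nullary using (yes; no; ¬_)
open import Relation.Nullary.Decidable using (⌊_⌋)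
open import Relation.Binary.PropositionalEquality
open import Relation.Binary.Construct.Closure.ReflexiveTransitive using (Star)
open import Algebra.Bundles using (RawGroup)
import Algebra.Construct.DirectProduct as DP
open import Algebra.Morphism.Structures using (module GroupMorphisms)

Σℕ : ∀ {n} → (Fin n → ℕ) → ℕ
Σℕ {zero}  f = 0
Σℕ {suc n} f = f Fin.zero ℕ.+ Σℕ (f ∘ Fin.suc)

Σℤ : ∀ {n} → (Fin n → ℤ) → ℤ
Σℤ {zero}  f = 0ℤ
Σℤ {suc n} f = f Fin.zero + Σℤ (f ∘ Fin.suc)

Σℤ-+ : ∀ {n} (f g : Fin n → ℤ) → Σℤ (λ j → f j + g j) ≡ Σℤ f + Σℤ g
Σℤ-+ {zero}  f g = refl
Σℤ-+ {suc n} f g rewrite Σℤ-+ (f ∘ Fin.suc) (g ∘ Fin.suc) =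
  lemma (f Fin.zero) (g Fin.zero) (Σℤ (f ∘ Fin.suc)) (Σℤ (g ∘ Fin.suc))
  where
    lemma : ∀ a b c d → (a + b) + (c + d) ≡ (a + c) + (b + d)
    lemma = solve-∀

Σℤ-cong : ∀ {n} {f g : Fin n → ℤ} → (∀ j → f j ≡ g j) → Σℤ f ≡ Σℤ g
Σℤ-cong {zero}  e = refl
Σℤ-cong {suc n} e = cong₂ _+_ (e Fin.zero) (Σℤ-cong (e ∘ Fin.suc))

Σℤ-* : ∀ {n} (c : ℤ) (f : Fin n → ℤ) → Σℤ (λ j → c * f j) ≡ c * Σℤ f
Σℤ-* {zero}  c f = sym (ℤP.*-zeroʳ c)
Σℤ-* {suc n} c f rewrite Σℤ-* c (f ∘ Fin.suc) =
  sym (ℤP.*-distribˡ-+ c (f Fin.zero) (Σℤ (f ∘ Fin.suc)))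

-- Finite directed multigraphs on the vertex set Fin k:
-- A v w = number of directed edges from v to w.

record Graph (k : ℕ) : Set where
  constructor graph
  field
    A : Fin k → Fin k → ℕ
open Graph public

Δ : ∀ {k} → Graph k → Fin k → ℕ
Δ G v = Σℕ (A G v)

Q : ∀ {k} → Graph k → Fin k → Fin k → ℤ
Q G v w = (if ⌊ v ≟ w ⌋ then + Δ G v else 0ℤ) - + A G v w

Qᵀ : ∀ {k} → Graph k → (Fin k → ℤ) → (Fin k → ℤ)
Qᵀ G x i = Σℤ (λ j → Q G j i * x j)

Qᵀ-+ : ∀ {k} (G : Graph k) (x y : Fin k → ℤ) i →
       Qᵀ G (λ j → x j + y j) i ≡ Qᵀ G x i + Qᵀ G y i
Qᵀ-+ G x y i =
  trans (Σℤ-cong (λ j → ℤP.*-distribˡ-+ (Q G j i) (x j) (y j)))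
        (Σℤ-+ (λ j → Q G j i * x j) (λ j → Q G j i * y j))

Qᵀ-* : ∀ {k} (G : Graph k) (c : ℤ) (x : Fin k → ℤ) i →
       Qᵀ G (λ j → c * x j) i ≡ c * Qᵀ G x i
Qᵀ-* G c x i =
  trans (Σℤ-cong (λ j → lemma (Q G j i) c (x j)))
        (Σℤ-* c (λ j → Q G j i * x j))
  where
    lemma : ∀ a b d → a * (b * d) ≡ b * (a * d)
    lemma = solve-∀

-- The group 𝒦(G) = ℤ^V / Qᵀ ℤ^V, as a raw group on ℤ^V whose equality
-- is congruence modulo the image of Qᵀ.

InImQᵀ : ∀ {k} → Graph k → (Fin k → ℤ) → Set
InImQᵀ G y = ∃[ z ] (∀ i → y i ≡ Qᵀ G z i)

_≈[_]_ : ∀ {k} → (Fin k → ℤ) → Graph k → (Fin k → ℤ) → Set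
x ≈[ G ] y = InImQᵀ G (λ i → x i - y i)

𝒦 : ∀ {k} → Graph k → RawGroup 0ℓ 0ℓ
𝒦 {k} G = record
  { Carrier = Fin k → ℤ
  ; _≈_     = λ x y → x ≈[ G ] y
  ; _∙_     = λ x y i → x i + y i
  ; ε       = λ _ → 0ℤ
  ; _⁻¹     = λ x i → - x i
  }

ℤ-rawGroup : RawGroup 0ℓ 0ℓ
ℤ-rawGroup = record
  { Carrier = ℤ ; _≈_ = _≡_ ; _∙_ = _+_ ; ε = 0ℤ ; _⁻¹ = -_ }

_⊕_ : RawGroup 0ℓ 0ℓ → RawGroup 0ℓ 0ℓ → RawGroup 0ℓ 0ℓ
_⊕_ = DP.rawGroup

IsTorsion : ∀ {k} → Graph k → (Fin k → ℤ) → Set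
IsTorsion G x = ∃[ m ] InImQᵀ G (λ i → + suc m * x i)

torsion-ε : ∀ {k} (G : Graph k) → IsTorsion G (λ _ → 0ℤ)
torsion-ε {k} G = 0 , (λ _ → 0ℤ) , λ i →
  sym (trans (Σℤ-cong (λ j → ℤP.*-zeroʳ (Q G j i))) (Σℤ-zero k))
  where
    Σℤ-zero : ∀ n → Σℤ {n} (λ _ → 0ℤ) ≡ 0ℤ
    Σℤ-zero zero    = refl
    Σℤ-zero (suc n) = trans (ℤP.+-identityˡ _) (Σℤ-zero n)

torsion-⁻¹ : ∀ {k} (G : Graph k) x → IsTorsion G x → IsTorsion G (λ i → - x i)
torsion-⁻¹ G x (m , z , e) = m , (λ j → -1ℤ * z j) , λ i →
  trans (sym (ℤP.neg-distribʳ-* (+ suc m) (x i)))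
  (trans (cong -_ (e i))
  (trans (sym (ℤP.-1*i≡-i (Qᵀ G z i)))
         (sym (Qᵀ-* G -1ℤ z i))))

torsion-∙ : ∀ {k} (G : Graph k) x y → IsTorsion G x → IsTorsion G y →
            IsTorsion G (λ i → x i + y i)
torsion-∙ G x y (m₁ , z₁ , e₁) (m₂ , z₂ , e₂) =
  m₂ ℕ.+ m₁ ℕ.* suc m₂ , (λ j → b * z₁ j + a * z₂ j) , λ i →
  trans (cong (_* (x i + y i)) (ℤP.pos-* (suc m₁) (suc m₂)))
  (trans (lemma a b (x i) (y i))
  (trans (cong₂ (λ p q → b * p + a * q) (e₁ i) (e₂ i))
  (trans (cong₂ _+_ (sym (Qᵀ-* G b z₁ i)) (sym (Qᵀ-* G a z₂ i)))
         (sym (Qᵀ-+ G (λ j → b * z₁ j) (λ j → a * z₂ j) i)))))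
  where
    a = + suc m₁
    b = + suc m₂
    lemma : ∀ p q s t → (p * q) * (s + t) ≡ q * (p * s) + p * (q * t)
    lemma = solve-∀

K : ∀ {k} → Graph k → RawGroup 0ℓ 0ℓ
K {k} G = record
  { Carrier = Σ (Fin k → ℤ) (IsTorsion G)
  ; _≈_     = λ x y → proj₁ x ≈[ G ] proj₁ y
  ; _∙_     = λ x y → (λ i → proj₁ x i + proj₁ y i)
                      , torsion-∙ G (proj₁ x) (proj₁ y) (proj₂ x) (proj₂ y)
  ; ε       = (λ _ → 0ℤ) , torsion-ε G
  ; _⁻¹     = λ x → (λ i → - proj₁ x i) , torsion-⁻¹ G (proj₁ x) (proj₂ x)
  }

_≅_ : RawGroup 0ℓ 0ℓ → RawGroup 0ℓ 0ℓ → Set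
G₁ ≅ G₂ = Σ[ f ∈ (RawGroup.Carrier G₁ → RawGroup.Carrier G₂) ]
            GroupMorphisms.IsGroupIsomorphism G₁ G₂ f

StronglyConnected : ∀ {k} → Graph k → Set
StronglyConnected {k} G = ∀ (u v : Fin k) → Star (λ x y → 0 ℕ.< A G x y) u v

gcdAll : ∀ {k} → (Fin k → ℕ) → ℕ
gcdAll {zero}  h = 0
gcdAll {suc k} h = gcd (h Fin.zero) (gcdAll (h ∘ Fin.suc))

IsActivityVector : ∀ {k} → Graph k → (Fin k → ℕ) → Set
IsActivityVector G h =
  (∀ i → 0 ℕ.< h i) × gcdAll h ≡ 1 × (∀ i → Qᵀ G (λ j → + h j) i ≡ 0ℤ)

-- v is simple: the activity vector takes the value 1 at v
-- (the activity vector is unique, so "some" = "the")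
SimpleVertex : ∀ {k} → Graph k → Fin k → Set
SimpleVertex G v = ∃[ h ] (IsActivityVector G h × h v ≡ 1)

-- G ∪ H on Fin (n + m): vertices of G come first (i ↑ˡ m), then those of H (n ↑ʳ j)
_∪_ : ∀ {n m} → Graph n → Graph m → Graph (n ℕ.+ m)
_∪_ {n} {m} G H = graph λ x y → go (splitAt n x) (splitAt n y)
  where
    go : _ → _ → ℕ
    go (inj₁ a) (inj₁ b) = A G a b
    go (inj₂ a) (inj₂ b) = A H a b
    go (inj₁ _) (inj₂ _) = 0
    go (inj₂ _) (inj₁ _) = 0

mergeMap : ∀ {n m} → Fin n → Fin (suc m) → Fin (n ℕ.+ suc m) → Fin (n ℕ.+ m)
mergeMap {n} {m} v w x with splitAt n x
... | inj₁ a = a ↑ˡ m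
... | inj₂ b with w ≟ b
...   | yes _  = v ↑ˡ m
...   | no w≢b = n ↑ʳ punchOut w≢b

-- (G ∪ H)/vw : edges are pushed forward along the quotient map
-- (number of edges a → b = number of edges x → y of G ∪ H with x ↦ a, y ↦ b)
identify : ∀ {n m} → Graph (n ℕ.+ suc m) → Fin n → Fin (suc m) → Graph (n ℕ.+ m)
identify {n} {m} U v w = graph λ a b →
  Σℕ λ x → Σℕ λ y →
    if ⌊ mergeMap v w x ≟ a ⌋ ∧ ⌊ mergeMap v w y ≟ b ⌋ then A U x y else 0

{-# OPTIONS --safe #-}
module Submission where

-- Let p be the vertex map of G ∪ H onto (G ∪ H)/vw, let push p sum a vector over the
-- fibres of p, and let Σᴴ sum it over the vertices of H. Then x ↦ (push p x , Σᴴ x) is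
-- a bijective linear map ℤ^V(G ∪ H) → ℤ^V((G ∪ H)/vw) × ℤ, and it carries im Qᵀ onto
-- im Q′ᵀ × 0. Indeed Σᴴ vanishes on im Qᵀ because the rows of Q_H sum to zero, and
-- push p (Qᵀ (z ∘ p)) = Q′ᵀ z. Every z can be brought into the form z′ ∘ p without
-- changing Qᵀ z, by adding a multiple of the activity vector of H extended by 0 on G:
-- it lies in ker Qᵀ and, w being simple, takes the value 1 at w and 0 at v. Torsion
-- elements have Σᴴ = 0, so the isomorphism of 𝒦 restricts to one of K.

open import Defs
open import Data.Nat as ℕ using (ℕ; zero; suc)
open import Data.Fin as Fin using (Fin; _↑ˡ_; _↑ʳ_; splitAt; punchIn; punchOut)
open import Data.Fin.Properties
  using (_≟_; splitAt-↑ˡ; splitAt-↑ʳ; ↑ˡ-injective; ↑ʳ-injective;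
         punchInᵢ≢i; punchOut-punchIn; punchIn-punchOut; punchOut-cong)
open import Data.Integer using (ℤ; +_; 0ℤ; 1ℤ; _+_; _*_; -_; _-_)
import Data.Integer.Properties as ℤP
open import Data.Integer.Tactic.RingSolver using (solve-∀)
open import Data.Bool using (true; false; if_then_else_; _∧_)
open import Data.Product using (∃-syntax; _×_; _,_; proj₁)
open import Data.Vec.Functional using (_++_)
open import Data.Vec.Functional.Properties using (lookup-++ˡ; lookup-++ʳ)
open import Function using (_∘_; flip)
open import Relation.Nullary using (yes; no; contradiction)
open import Relation.Nullary.Decidable using (⌊_⌋)
open import Relation.Binary.PropositionalEquality
open import Algebra.Properties.Semiring.Sum ℤP.+-*-semiring
  using (sum; sum-cong-≗; sum-remove; ∑-comm)

open ≡-Reasoning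

δ : ∀ {k} → Fin k → Fin k → ℤ
δ a b = if ⌊ a ≟ b ⌋ then 1ℤ else 0ℤ

δ-refl : ∀ {k} (a : Fin k) → δ a a ≡ 1ℤ
δ-refl a with a ≟ a
... | yes _   = refl
... | no a≢a = contradiction refl a≢a

δ-≢ : ∀ {k} {a b : Fin k} → a ≢ b → δ a b ≡ 0ℤ
δ-≢ {a = a} {b} a≢b with a ≟ b
... | yes a≡b = contradiction a≡b a≢b
... | no _    = refl

δ-injective : ∀ {k l} {f : Fin k → Fin l} → (∀ {a b} → f a ≡ f b → a ≡ b) →
              ∀ a b → δ (f a) (f b) ≡ δ a b
δ-injective f-inj a b with a ≟ b
... | yes refl = δ-refl _
... | no a≢b  = δ-≢ (a≢b ∘ f-inj)

δ-sym : ∀ {k} (a b : Fin k) → δ a b ≡ δ b a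
δ-sym a b with a ≟ b
... | yes refl = sym (δ-refl a)
... | no a≢b  = sym (δ-≢ (a≢b ∘ sym))

δ-*-subst : ∀ {k} (c a : Fin k) (g : Fin k → ℤ) → δ c a * g a ≡ δ c a * g c
δ-*-subst c a g with c ≟ a
... | yes refl = refl
... | no _     = refl

Σℤ≡sum : ∀ {n} (f : Fin n → ℤ) → Σℤ f ≡ sum f
Σℤ≡sum {zero}  f = refl
Σℤ≡sum {suc n} f = cong (_+_ (f Fin.zero)) (Σℤ≡sum (f ∘ Fin.suc))

Σℤ-zero : ∀ {n} {f : Fin n → ℤ} → (∀ j → f j ≡ 0ℤ) → Σℤ f ≡ 0ℤ
Σℤ-zero {zero}  f≡0 = refl
Σℤ-zero {suc n} f≡0 = cong₂ _+_ (f≡0 Fin.zero) (Σℤ-zero (f≡0 ∘ Fin.suc))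

Σℤ-neg : ∀ {n} (f : Fin n → ℤ) → Σℤ (λ j → - f j) ≡ - Σℤ f
Σℤ-neg {zero}  f = refl
Σℤ-neg {suc n} f = trans (cong (_+_ (- f Fin.zero)) (Σℤ-neg (f ∘ Fin.suc)))
                         (sym (ℤP.neg-distrib-+ (f Fin.zero) _))

Σℤ-sub : ∀ {n} (f g : Fin n → ℤ) → Σℤ (λ j → f j - g j) ≡ Σℤ f - Σℤ g
Σℤ-sub f g = trans (Σℤ-+ f (λ j → - g j)) (cong (_+_ (Σℤ f)) (Σℤ-neg g))

Σℤ-*ʳ : ∀ {n} (c : ℤ) (f : Fin n → ℤ) → Σℤ (λ j → f j * c) ≡ Σℤ f * c
Σℤ-*ʳ c f = trans (Σℤ-cong (λ j → ℤP.*-comm (f j) c)) (trans (Σℤ-* c f) (ℤP.*-comm c _))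

Σℤ-comm : ∀ {n k} (f : Fin n → Fin k → ℤ) →
          Σℤ (λ i → Σℤ (f i)) ≡ Σℤ (λ j → Σℤ (λ i → f i j))
Σℤ-comm f = trans (Σℤ²≡sum² f) (trans (∑-comm f) (sym (Σℤ²≡sum² (flip f))))
  where
    Σℤ²≡sum² : ∀ {n k} (g : Fin n → Fin k → ℤ) →
               Σℤ (λ i → Σℤ (g i)) ≡ sum (λ i → sum (g i))
    Σℤ²≡sum² g = trans (Σℤ≡sum (λ i → Σℤ (g i))) (sum-cong-≗ (Σℤ≡sum ∘ g))

Σℤ-punchIn : ∀ {m} (w : Fin (suc m)) (f : Fin (suc m) → ℤ) →
             Σℤ f ≡ f w + Σℤ (f ∘ punchIn w)
Σℤ-punchIn w f =
  trans (Σℤ≡sum f) (trans (sum-remove {i = w} f)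
                           (cong (_+_ (f w)) (sym (Σℤ≡sum (f ∘ punchIn w)))))

Σℤ-↑ˡ-↑ʳ : ∀ n {k} (f : Fin (n ℕ.+ k) → ℤ) →
           Σℤ f ≡ Σℤ (λ a → f (a ↑ˡ k)) + Σℤ (λ b → f (n ↑ʳ b))
Σℤ-↑ˡ-↑ʳ zero    f = sym (ℤP.+-identityˡ _)
Σℤ-↑ˡ-↑ʳ (suc n) f = trans (cong (_+_ (f Fin.zero)) (Σℤ-↑ˡ-↑ʳ n (f ∘ Fin.suc)))
                           (sym (ℤP.+-assoc (f Fin.zero) _ _))

pos-Σℕ : ∀ {n} (f : Fin n → ℕ) → + Σℕ f ≡ Σℤ (λ j → + f j)
pos-Σℕ {zero}  f = refl
pos-Σℕ {suc n} f = trans (ℤP.pos-+ (f Fin.zero) (Σℕ (f ∘ Fin.suc)))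
                         (cong (_+_ (+ f Fin.zero)) (pos-Σℕ (f ∘ Fin.suc)))

Σℤ-δˡ : ∀ {k} (c : Fin k) (g : Fin k → ℤ) → Σℤ (λ b → δ c b * g b) ≡ g c
Σℤ-δˡ {suc k} c g = begin
  Σℤ (λ b → δ c b * g b)
    ≡⟨ Σℤ-punchIn c (λ b → δ c b * g b) ⟩
  δ c c * g c + Σℤ (λ j → δ c (punchIn c j) * g (punchIn c j))
    ≡⟨ cong₂ _+_ (cong (_* g c) (δ-refl c))
                 (Σℤ-zero (λ j → cong (_* g (punchIn c j)) (δ-≢ (punchInᵢ≢i c j ∘ sym)))) ⟩
  1ℤ * g c + 0ℤ
    ≡⟨ trans (ℤP.+-identityʳ _) (ℤP.*-identityˡ (g c)) ⟩
  g c ∎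

Σℤ-δʳ : ∀ {k} (c : Fin k) (g : Fin k → ℤ) → Σℤ (λ b → δ b c * g b) ≡ g c
Σℤ-δʳ c g = trans (Σℤ-cong (λ b → cong (_* g b) (δ-sym b c))) (Σℤ-δˡ c g)

push : ∀ {N N′} → (Fin N → Fin N′) → (Fin N → ℤ) → Fin N′ → ℤ
push p g a = Σℤ (λ y → δ (p y) a * g y)

module _ {N N′} (p : Fin N → Fin N′) where

  push-cong : ∀ {x y : Fin N → ℤ} → x ≗ y → push p x ≗ push p y
  push-cong x≗y a = Σℤ-cong (λ i → cong (δ (p i) a *_) (x≗y i))

  push-zero : push p (λ _ → 0ℤ) ≗ (λ _ → 0ℤ)
  push-zero a = Σℤ-zero (λ i → ℤP.*-zeroʳ (δ (p i) a))

  push-+ : ∀ x y → push p (λ i → x i + y i) ≗ (λ a → push p x a + push p y a)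
  push-+ x y a = trans (Σℤ-cong (λ i → ℤP.*-distribˡ-+ (δ (p i) a) (x i) (y i)))
                       (Σℤ-+ (λ i → δ (p i) a * x i) (λ i → δ (p i) a * y i))

  push-neg : ∀ x → push p (λ i → - x i) ≗ (λ a → - push p x a)
  push-neg x a = trans (Σℤ-cong (λ i → sym (ℤP.neg-distribʳ-* (δ (p i) a) (x i))))
                       (Σℤ-neg (λ i → δ (p i) a * x i))

  push-sub : ∀ x y → push p (λ i → x i - y i) ≗ (λ a → push p x a - push p y a)
  push-sub x y a = trans (push-+ x (λ i → - y i) a) (cong (_+_ (push p x a)) (push-neg y a))

  push-* : ∀ s x → push p (λ i → s * x i) ≗ (λ a → s * push p x a)
  push-* s x a = trans (Σℤ-cong (λ i → swap (δ (p i) a) s (x i)))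
                       (Σℤ-* s (λ i → δ (p i) a * x i))
    where
      swap : ∀ d s t → d * (s * t) ≡ s * (d * t)
      swap = solve-∀

Qᵀ-cong : ∀ {k} (G : Graph k) {z z′ : Fin k → ℤ} → z ≗ z′ → Qᵀ G z ≗ Qᵀ G z′
Qᵀ-cong G z≗z′ i = Σℤ-cong (λ j → cong (Q G j i *_) (z≗z′ j))

Qᵀ-zero : ∀ {k} (G : Graph k) → Qᵀ G (λ _ → 0ℤ) ≗ (λ _ → 0ℤ)
Qᵀ-zero G i = Σℤ-zero (λ j → ℤP.*-zeroʳ (Q G j i))

InImQᵀ-resp-≗ : ∀ {k} (G : Graph k) {x y : Fin k → ℤ} → x ≗ y → InImQᵀ G y → InImQᵀ G x
InImQᵀ-resp-≗ G x≗y (z , y≗Qᵀz) = z , λ i → trans (x≗y i) (y≗Qᵀz i)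

≗⇒≈ : ∀ {k} (G : Graph k) {x y : Fin k → ℤ} → x ≗ y → x ≈[ G ] y
≗⇒≈ G x≗y = (λ _ → 0ℤ) , λ i → trans (ℤP.i≡j⇒i-j≡0 (x≗y i)) (sym (Qᵀ-zero G i))

≈-trans : ∀ {k} (G : Graph k) {x y t : Fin k → ℤ} → x ≈[ G ] y → y ≈[ G ] t → x ≈[ G ] t
≈-trans G {x} {y} {t} (z₁ , e₁) (z₂ , e₂) = (λ j → z₁ j + z₂ j) , λ i →
  trans (telescope (x i) (y i) (t i))
        (trans (cong₂ _+_ (e₁ i) (e₂ i)) (sym (Qᵀ-+ G z₁ z₂ i)))
  where
    telescope : ∀ a b c → a - c ≡ (a - b) + (b - c)
    telescope = solve-∀

Q-δ : ∀ {k} (G : Graph k) u v → Q G u v ≡ δ u v * + Δ G u - + A G u v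
Q-δ G u v with u ≟ v
... | yes _ = cong (_- + A G u v) (sym (ℤP.*-identityˡ (+ Δ G u)))
... | no _  = refl

Qᵀ-expand : ∀ {k} (G : Graph k) (z : Fin k → ℤ) i →
            Qᵀ G z i ≡ + Δ G i * z i - Σℤ (λ j → + A G j i * z j)
Qᵀ-expand G z i = begin
  Σℤ (λ j → Q G j i * z j)
    ≡⟨ Σℤ-cong (λ j → trans (cong (_* z j) (Q-δ G j i))
                            (distrib (δ j i) (+ Δ G j) (+ A G j i) (z j))) ⟩
  Σℤ (λ j → δ j i * (+ Δ G j * z j) - + A G j i * z j)
    ≡⟨ Σℤ-sub (λ j → δ j i * (+ Δ G j * z j)) (λ j → + A G j i * z j) ⟩
  Σℤ (λ j → δ j i * (+ Δ G j * z j)) - Σℤ (λ j → + A G j i * z j)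
    ≡⟨ cong (_- Σℤ (λ j → + A G j i * z j)) (Σℤ-δʳ i (λ j → + Δ G j * z j)) ⟩
  + Δ G i * z i - Σℤ (λ j → + A G j i * z j) ∎
  where
    distrib : ∀ d D a x → (d * D - a) * x ≡ d * (D * x) - a * x
    distrib = solve-∀

Σℤ-Q-row : ∀ {k} (G : Graph k) u → Σℤ (Q G u) ≡ 0ℤ
Σℤ-Q-row G u = begin
  Σℤ (Q G u)
    ≡⟨ Σℤ-cong (Q-δ G u) ⟩
  Σℤ (λ v → δ u v * + Δ G u - + A G u v)
    ≡⟨ Σℤ-sub (λ v → δ u v * + Δ G u) (λ v → + A G u v) ⟩
  Σℤ (λ v → δ u v * + Δ G u) - Σℤ (λ v → + A G u v)
    ≡⟨ cong₂ _-_ (Σℤ-δˡ u (λ _ → + Δ G u)) (sym (pos-Σℕ (A G u))) ⟩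
  + Δ G u - + Δ G u
    ≡⟨ ℤP.+-inverseʳ (+ Δ G u) ⟩
  0ℤ ∎

Σℤ-Qᵀ : ∀ {k} (G : Graph k) (z : Fin k → ℤ) → Σℤ (Qᵀ G z) ≡ 0ℤ
Σℤ-Qᵀ G z = begin
  Σℤ (λ i → Σℤ (λ j → Q G j i * z j))
    ≡⟨ Σℤ-comm (λ i j → Q G j i * z j) ⟩
  Σℤ (λ j → Σℤ (λ i → Q G j i * z j))
    ≡⟨ Σℤ-cong (λ j → Σℤ-*ʳ (z j) (Q G j)) ⟩
  Σℤ (λ j → Σℤ (Q G j) * z j)
    ≡⟨ Σℤ-zero (λ j → cong (_* z j) (Σℤ-Q-row G j)) ⟩
  0ℤ ∎

-- identify U v w is, by definition, pushforward U (mergeMap v w).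
pushforward : ∀ {N N′} → Graph N → (Fin N → Fin N′) → Graph N′
pushforward U p = graph λ a b →
  Σℕ λ x → Σℕ λ y → if ⌊ p x ≟ a ⌋ ∧ ⌊ p y ≟ b ⌋ then A U x y else 0

module _ {N N′} (U : Graph N) (p : Fin N → Fin N′) where

  private
    U′ : Graph N′
    U′ = pushforward U p

  A-pushforward : ∀ a b →
    + A U′ a b ≡ Σℤ (λ x → Σℤ (λ y → δ (p x) a * (δ (p y) b * + A U x y)))
  A-pushforward a b =
    trans (pos-Σℕ (λ x → Σℕ (edges x))) (Σℤ-cong λ x →
      trans (pos-Σℕ (edges x)) (Σℤ-cong λ y → pos-if-∧ ⌊ p x ≟ a ⌋ ⌊ p y ≟ b ⌋ (A U x y)))
    where
      edges : Fin N → Fin N → ℕ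
      edges x y = if ⌊ p x ≟ a ⌋ ∧ ⌊ p y ≟ b ⌋ then A U x y else 0
      pos-if-∧ : ∀ c d t → + (if c ∧ d then t else 0) ≡
                 (if c then 1ℤ else 0ℤ) * ((if d then 1ℤ else 0ℤ) * + t)
      pos-if-∧ true  true  t = sym (trans (ℤP.*-identityˡ _) (ℤP.*-identityˡ _))
      pos-if-∧ true  false t = refl
      pos-if-∧ false d     t = refl

  Δ-pushforward : ∀ a → + Δ U′ a ≡ Σℤ (λ x → δ (p x) a * + Δ U x)
  Δ-pushforward a = begin
    + Σℕ (A U′ a)
      ≡⟨ pos-Σℕ (A U′ a) ⟩
    Σℤ (λ b → + A U′ a b)
      ≡⟨ Σℤ-cong (A-pushforward a) ⟩
    Σℤ (λ b → Σℤ (λ x → Σℤ (λ y → F x y b)))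
      ≡⟨ Σℤ-comm (λ b x → Σℤ (λ y → F x y b)) ⟩
    Σℤ (λ x → Σℤ (λ b → Σℤ (λ y → F x y b)))
      ≡⟨ Σℤ-cong (λ x → Σℤ-comm (λ b y → F x y b)) ⟩
    Σℤ (λ x → Σℤ (λ y → Σℤ (λ b → F x y b)))
      ≡⟨ Σℤ-cong (λ x → Σℤ-cong (λ y →
           trans (Σℤ-cong (λ b → swap (δ (p x) a) (δ (p y) b) (+ A U x y)))
                 (Σℤ-δˡ (p y) (λ _ → δ (p x) a * + A U x y)))) ⟩
    Σℤ (λ x → Σℤ (λ y → δ (p x) a * + A U x y))
      ≡⟨ Σℤ-cong (λ x → trans (Σℤ-* (δ (p x) a) (λ y → + A U x y))
                              (cong (δ (p x) a *_) (sym (pos-Σℕ (A U x))))) ⟩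
    Σℤ (λ x → δ (p x) a * + Δ U x) ∎
    where
      F : Fin N → Fin N → Fin N′ → ℤ
      F x y b = δ (p x) a * (δ (p y) b * + A U x y)
      swap : ∀ d e t → d * (e * t) ≡ e * (d * t)
      swap = solve-∀

  push-diagonal : ∀ (z : Fin N′ → ℤ) a →
    + Δ U′ a * z a ≡ push p (λ y → + Δ U y * z (p y)) a
  push-diagonal z a = begin
    + Δ U′ a * z a
      ≡⟨ cong (_* z a) (Δ-pushforward a) ⟩
    Σℤ (λ x → δ (p x) a * + Δ U x) * z a
      ≡⟨ Σℤ-*ʳ (z a) (λ x → δ (p x) a * + Δ U x) ⟨
    Σℤ (λ x → δ (p x) a * + Δ U x * z a)
      ≡⟨ Σℤ-cong (λ x → trans (ℤP.*-assoc (δ (p x) a) (+ Δ U x) (z a))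
                              (δ-*-subst (p x) a (λ t → + Δ U x * z t))) ⟩
    push p (λ y → + Δ U y * z (p y)) a ∎

  push-adjacency : ∀ (z : Fin N′ → ℤ) a →
    Σℤ (λ b → + A U′ b a * z b) ≡ push p (λ y → Σℤ (λ x → + A U x y * z (p x))) a
  push-adjacency z a = begin
    Σℤ (λ b → + A U′ b a * z b)
      ≡⟨ Σℤ-cong (λ b → trans (cong (_* z b) (A-pushforward b a)) (pull-in b)) ⟩
    Σℤ (λ b → Σℤ (λ x → Σℤ (λ y → F b x y)))
      ≡⟨ Σℤ-comm (λ b x → Σℤ (λ y → F b x y)) ⟩
    Σℤ (λ x → Σℤ (λ b → Σℤ (λ y → F b x y)))
      ≡⟨ Σℤ-cong (λ x → Σℤ-comm (λ b y → F b x y)) ⟩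
    Σℤ (λ x → Σℤ (λ y → Σℤ (λ b → F b x y)))
      ≡⟨ Σℤ-cong (λ x → Σℤ-cong (λ y →
           trans (Σℤ-cong (λ b → reassoc (δ (p x) b) (δ (p y) a) (+ A U x y) (z b)))
                 (Σℤ-δˡ (p x) (λ b → δ (p y) a * (+ A U x y * z b))))) ⟩
    Σℤ (λ x → Σℤ (λ y → δ (p y) a * (+ A U x y * z (p x))))
      ≡⟨ Σℤ-comm (λ x y → δ (p y) a * (+ A U x y * z (p x))) ⟩
    Σℤ (λ y → Σℤ (λ x → δ (p y) a * (+ A U x y * z (p x))))
      ≡⟨ Σℤ-cong (λ y → Σℤ-* (δ (p y) a) (λ x → + A U x y * z (p x))) ⟩
    push p (λ y → Σℤ (λ x → + A U x y * z (p x))) a ∎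
    where
      F : Fin N′ → Fin N → Fin N → ℤ
      F b x y = δ (p x) b * (δ (p y) a * + A U x y) * z b
      pull-in : ∀ b → Σℤ (λ x → Σℤ (λ y → δ (p x) b * (δ (p y) a * + A U x y))) * z b
                      ≡ Σℤ (λ x → Σℤ (λ y → F b x y))
      pull-in b =
        trans (sym (Σℤ-*ʳ (z b) (λ x → Σℤ (λ y → δ (p x) b * (δ (p y) a * + A U x y)))))
              (Σℤ-cong (λ x → sym (Σℤ-*ʳ (z b) (λ y → δ (p x) b * (δ (p y) a * + A U x y)))))
      reassoc : ∀ d e t s → d * (e * t) * s ≡ d * (e * (t * s))
      reassoc = solve-∀

  push-Qᵀ : ∀ (z : Fin N′ → ℤ) → push p (Qᵀ U (z ∘ p)) ≗ Qᵀ U′ z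
  push-Qᵀ z a = begin
    push p (Qᵀ U (z ∘ p)) a
      ≡⟨ push-cong p (Qᵀ-expand U (z ∘ p)) a ⟩
    push p (λ y → + Δ U y * z (p y) - Σℤ (λ x → + A U x y * z (p x))) a
      ≡⟨ push-sub p _ _ a ⟩
    push p (λ y → + Δ U y * z (p y)) a - push p (λ y → Σℤ (λ x → + A U x y * z (p x))) a
      ≡⟨ cong₂ _-_ (push-diagonal z a) (push-adjacency z a) ⟨
    + Δ U′ a * z a - Σℤ (λ b → + A U′ b a * z b)
      ≡⟨ Qᵀ-expand U′ z a ⟨
    Qᵀ U′ z a ∎

data SplitView (n k : ℕ) : Fin (n ℕ.+ k) → Set where
  inˡ : ∀ a → SplitView n k (a ↑ˡ k)
  inʳ : ∀ b → SplitView n k (n ↑ʳ b)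

splitView : ∀ n {k} (x : Fin (n ℕ.+ k)) → SplitView n k x
splitView zero    x           = inʳ x
splitView (suc n) Fin.zero    = inˡ Fin.zero
splitView (suc n) (Fin.suc x) with splitView n x
... | inˡ a = inˡ (Fin.suc a)
... | inʳ b = inʳ b

↑ˡ≢↑ʳ : ∀ n {k} (a : Fin n) (b : Fin k) → a ↑ˡ k ≢ n ↑ʳ b
↑ˡ≢↑ʳ n {k} a b eq
  with trans (sym (splitAt-↑ˡ n a k)) (trans (cong (splitAt n) eq) (splitAt-↑ʳ n k b))
... | ()

module _ {n k} (G : Graph n) (H : Graph k) where

  private
    U = G ∪ H

  A-∪ˡˡ : ∀ a b → A U (a ↑ˡ k) (b ↑ˡ k) ≡ A G a b
  A-∪ˡˡ a b rewrite splitAt-↑ˡ n a k | splitAt-↑ˡ n b k = refl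

  A-∪ʳʳ : ∀ a b → A U (n ↑ʳ a) (n ↑ʳ b) ≡ A H a b
  A-∪ʳʳ a b rewrite splitAt-↑ʳ n k a | splitAt-↑ʳ n k b = refl

  A-∪ˡʳ : ∀ a b → A U (a ↑ˡ k) (n ↑ʳ b) ≡ 0
  A-∪ˡʳ a b rewrite splitAt-↑ˡ n a k | splitAt-↑ʳ n k b = refl

  A-∪ʳˡ : ∀ a b → A U (n ↑ʳ a) (b ↑ˡ k) ≡ 0
  A-∪ʳˡ a b rewrite splitAt-↑ʳ n k a | splitAt-↑ˡ n b k = refl

  Δ-∪ˡ : ∀ a → + Δ U (a ↑ˡ k) ≡ + Δ G a
  Δ-∪ˡ a = begin
    + Δ U (a ↑ˡ k)
      ≡⟨ trans (pos-Σℕ (A U (a ↑ˡ k))) (Σℤ-↑ˡ-↑ʳ n (λ y → + A U (a ↑ˡ k) y)) ⟩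
    Σℤ (λ b → + A U (a ↑ˡ k) (b ↑ˡ k)) + Σℤ (λ b → + A U (a ↑ˡ k) (n ↑ʳ b))
      ≡⟨ cong₂ _+_ (Σℤ-cong (λ b → cong +_ (A-∪ˡˡ a b)))
                   (Σℤ-zero (λ b → cong +_ (A-∪ˡʳ a b))) ⟩
    Σℤ (λ b → + A G a b) + 0ℤ
      ≡⟨ trans (ℤP.+-identityʳ _) (sym (pos-Σℕ (A G a))) ⟩
    + Δ G a ∎

  Δ-∪ʳ : ∀ a → + Δ U (n ↑ʳ a) ≡ + Δ H a
  Δ-∪ʳ a = begin
    + Δ U (n ↑ʳ a)
      ≡⟨ trans (pos-Σℕ (A U (n ↑ʳ a))) (Σℤ-↑ˡ-↑ʳ n (λ y → + A U (n ↑ʳ a) y)) ⟩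
    Σℤ (λ b → + A U (n ↑ʳ a) (b ↑ˡ k)) + Σℤ (λ b → + A U (n ↑ʳ a) (n ↑ʳ b))
      ≡⟨ cong₂ _+_ (Σℤ-zero (λ b → cong +_ (A-∪ʳˡ a b)))
                   (Σℤ-cong (λ b → cong +_ (A-∪ʳʳ a b))) ⟩
    0ℤ + Σℤ (λ b → + A H a b)
      ≡⟨ trans (ℤP.+-identityˡ _) (sym (pos-Σℕ (A H a))) ⟩
    + Δ H a ∎

  Q-∪ˡˡ : ∀ a b → Q U (a ↑ˡ k) (b ↑ˡ k) ≡ Q G a b
  Q-∪ˡˡ a b = begin
    Q U (a ↑ˡ k) (b ↑ˡ k)                                          ≡⟨ Q-δ U (a ↑ˡ k) (b ↑ˡ k) ⟩
    δ (a ↑ˡ k) (b ↑ˡ k) * + Δ U (a ↑ˡ k) - + A U (a ↑ˡ k) (b ↑ˡ k)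
      ≡⟨ cong₂ _-_ (cong₂ _*_ (δ-injective (↑ˡ-injective k _ _) a b) (Δ-∪ˡ a))
                   (cong +_ (A-∪ˡˡ a b)) ⟩
    δ a b * + Δ G a - + A G a b                                    ≡⟨ Q-δ G a b ⟨
    Q G a b                                                        ∎

  Q-∪ʳʳ : ∀ a b → Q U (n ↑ʳ a) (n ↑ʳ b) ≡ Q H a b
  Q-∪ʳʳ a b = begin
    Q U (n ↑ʳ a) (n ↑ʳ b)                                          ≡⟨ Q-δ U (n ↑ʳ a) (n ↑ʳ b) ⟩
    δ (n ↑ʳ a) (n ↑ʳ b) * + Δ U (n ↑ʳ a) - + A U (n ↑ʳ a) (n ↑ʳ b)
      ≡⟨ cong₂ _-_ (cong₂ _*_ (δ-injective (↑ʳ-injective n _ _) a b) (Δ-∪ʳ a))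
                   (cong +_ (A-∪ʳʳ a b)) ⟩
    δ a b * + Δ H a - + A H a b                                    ≡⟨ Q-δ H a b ⟨
    Q H a b                                                        ∎

  Q-∪ˡʳ : ∀ a b → Q U (a ↑ˡ k) (n ↑ʳ b) ≡ 0ℤ
  Q-∪ˡʳ a b = trans (Q-δ U (a ↑ˡ k) (n ↑ʳ b))
    (cong₂ (λ d e → d * + Δ U (a ↑ˡ k) - + e) (δ-≢ (↑ˡ≢↑ʳ n a b)) (A-∪ˡʳ a b))

  Q-∪ʳˡ : ∀ a b → Q U (n ↑ʳ a) (b ↑ˡ k) ≡ 0ℤ
  Q-∪ʳˡ a b = trans (Q-δ U (n ↑ʳ a) (b ↑ˡ k))
    (cong₂ (λ d e → d * + Δ U (n ↑ʳ a) - + e) (δ-≢ (↑ˡ≢↑ʳ n b a ∘ sym)) (A-∪ʳˡ a b))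

  Qᵀ-∪ˡ : ∀ (z : Fin (n ℕ.+ k) → ℤ) a → Qᵀ U z (a ↑ˡ k) ≡ Qᵀ G (λ b → z (b ↑ˡ k)) a
  Qᵀ-∪ˡ z a = begin
    Qᵀ U z (a ↑ˡ k)
      ≡⟨ Σℤ-↑ˡ-↑ʳ n (λ x → Q U x (a ↑ˡ k) * z x) ⟩
    Σℤ (λ b → Q U (b ↑ˡ k) (a ↑ˡ k) * z (b ↑ˡ k))
      + Σℤ (λ b → Q U (n ↑ʳ b) (a ↑ˡ k) * z (n ↑ʳ b))
      ≡⟨ cong₂ _+_ (Σℤ-cong (λ b → cong (_* z (b ↑ˡ k)) (Q-∪ˡˡ b a)))
                   (Σℤ-zero (λ b → cong (_* z (n ↑ʳ b)) (Q-∪ʳˡ b a))) ⟩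
    Qᵀ G (λ b → z (b ↑ˡ k)) a + 0ℤ
      ≡⟨ ℤP.+-identityʳ _ ⟩
    Qᵀ G (λ b → z (b ↑ˡ k)) a ∎

  Qᵀ-∪ʳ : ∀ (z : Fin (n ℕ.+ k) → ℤ) a → Qᵀ U z (n ↑ʳ a) ≡ Qᵀ H (λ b → z (n ↑ʳ b)) a
  Qᵀ-∪ʳ z a = begin
    Qᵀ U z (n ↑ʳ a)
      ≡⟨ Σℤ-↑ˡ-↑ʳ n (λ x → Q U x (n ↑ʳ a) * z x) ⟩
    Σℤ (λ b → Q U (b ↑ˡ k) (n ↑ʳ a) * z (b ↑ˡ k))
      + Σℤ (λ b → Q U (n ↑ʳ b) (n ↑ʳ a) * z (n ↑ʳ b))
      ≡⟨ cong₂ _+_ (Σℤ-zero (λ b → cong (_* z (b ↑ˡ k)) (Q-∪ˡʳ b a)))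
                   (Σℤ-cong (λ b → cong (_* z (n ↑ʳ b)) (Q-∪ʳʳ b a))) ⟩
    0ℤ + Qᵀ H (λ b → z (n ↑ʳ b)) a
      ≡⟨ ℤP.+-identityˡ _ ⟩
    Qᵀ H (λ b → z (n ↑ʳ b)) a ∎

  Qᵀ-∪-++ : ∀ {x : Fin n → ℤ} {y : Fin k → ℤ} →
            (∀ a → Qᵀ G x a ≡ 0ℤ) → (∀ b → Qᵀ H y b ≡ 0ℤ) → ∀ u → Qᵀ U (x ++ y) u ≡ 0ℤ
  Qᵀ-∪-++ {x} {y} Qᵀx≡0 Qᵀy≡0 u with splitView n u
  ... | inˡ a = trans (Qᵀ-∪ˡ (x ++ y) a) (trans (Qᵀ-cong G (lookup-++ˡ x y) a) (Qᵀx≡0 a))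
  ... | inʳ b = trans (Qᵀ-∪ʳ (x ++ y) b) (trans (Qᵀ-cong H (lookup-++ʳ x y) b) (Qᵀy≡0 b))

push-fibre : ∀ {N N′} {p : Fin N → Fin N′} {ι : Fin N′ → Fin N} {w₀ : Fin N} →
  (∀ a → p (ι a) ≡ a) → (∀ a → ι a ≢ w₀) → (∀ y → y ≢ w₀ → ι (p y) ≡ y) →
  ∀ (g : Fin N → ℤ) a → push p g a ≡ g (ι a) + δ (p w₀) a * g w₀
push-fibre {p = p} {ι} {w₀} p∘ι ι≢w₀ ι∘p g a = begin
  Σℤ (λ y → δ (p y) a * g y)
    ≡⟨ Σℤ-cong (λ y → trans (cong (_* g y) (δ-p y))
                            (distrib (δ y (ι a)) (δ y w₀) d (g y))) ⟩
  Σℤ (λ y → δ y (ι a) * g y + δ y w₀ * (d * g y))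
    ≡⟨ Σℤ-+ (λ y → δ y (ι a) * g y) (λ y → δ y w₀ * (d * g y)) ⟩
  Σℤ (λ y → δ y (ι a) * g y) + Σℤ (λ y → δ y w₀ * (d * g y))
    ≡⟨ cong₂ _+_ (Σℤ-δʳ (ι a) g) (Σℤ-δʳ w₀ (λ y → d * g y)) ⟩
  g (ι a) + d * g w₀ ∎
  where
    d : ℤ
    d = δ (p w₀) a
    distrib : ∀ e f d x → (e + f * d) * x ≡ e * x + f * (d * x)
    distrib = solve-∀
    ι-injective : ∀ {a b} → ι a ≡ ι b → a ≡ b
    ι-injective {a} {b} ιa≡ιb = trans (sym (p∘ι a)) (trans (cong p ιa≡ιb) (p∘ι b))
    δ-p : ∀ y → δ (p y) a ≡ δ y (ι a) + δ y w₀ * d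
    δ-p y with y ≟ w₀
    ... | yes y≡w₀ = begin
      δ (p y) a                ≡⟨ cong (λ t → δ (p t) a) y≡w₀ ⟩
      d                        ≡⟨ ℤP.*-identityˡ d ⟨
      1ℤ * d                   ≡⟨ ℤP.+-identityˡ _ ⟨
      0ℤ + 1ℤ * d              ≡⟨ cong (_+ 1ℤ * d) (δ-≢ (ι≢w₀ a ∘ flip trans y≡w₀ ∘ sym)) ⟨
      δ y (ι a) + 1ℤ * d       ∎
    ... | no y≢w₀ = begin
      δ (p y) a                ≡⟨ δ-injective ι-injective (p y) a ⟨
      δ (ι (p y)) (ι a)        ≡⟨ cong (λ t → δ t (ι a)) (ι∘p y y≢w₀) ⟩
      δ y (ι a)                ≡⟨ ℤP.+-identityʳ _ ⟨
      δ y (ι a) + 0ℤ           ∎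

module _ {n m} (v : Fin n) (w : Fin (suc m)) where

  unmerge : Fin (n ℕ.+ m) → Fin (n ℕ.+ suc m)
  unmerge = (_↑ˡ suc m) ++ (λ j → n ↑ʳ punchIn w j)

  unmerge-↑ˡ : ∀ a → unmerge (a ↑ˡ m) ≡ a ↑ˡ suc m
  unmerge-↑ˡ = lookup-++ˡ (_↑ˡ suc m) (λ j → n ↑ʳ punchIn w j)

  unmerge-↑ʳ : ∀ j → unmerge (n ↑ʳ j) ≡ n ↑ʳ punchIn w j
  unmerge-↑ʳ = lookup-++ʳ (_↑ˡ suc m) (λ j → n ↑ʳ punchIn w j)

  mergeMap-↑ˡ : ∀ a → mergeMap v w (a ↑ˡ suc m) ≡ a ↑ˡ m
  mergeMap-↑ˡ a rewrite splitAt-↑ˡ n a (suc m) = refl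

  mergeMap-w : mergeMap v w (n ↑ʳ w) ≡ v ↑ˡ m
  mergeMap-w rewrite splitAt-↑ʳ n (suc m) w with w ≟ w
  ... | yes _   = refl
  ... | no w≢w = contradiction refl w≢w

  mergeMap-≢w : ∀ b (w≢b : w ≢ b) → mergeMap v w (n ↑ʳ b) ≡ n ↑ʳ punchOut w≢b
  mergeMap-≢w b w≢b rewrite splitAt-↑ʳ n (suc m) b with w ≟ b
  ... | yes w≡b = contradiction w≡b w≢b
  ... | no _    = cong (n ↑ʳ_) (punchOut-cong w refl)

  mergeMap-unmerge : ∀ a → mergeMap v w (unmerge a) ≡ a
  mergeMap-unmerge a with splitView n a
  ... | inˡ a₀ = trans (cong (mergeMap v w) (unmerge-↑ˡ a₀)) (mergeMap-↑ˡ a₀)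
  ... | inʳ j  = begin
    mergeMap v w (unmerge (n ↑ʳ j))        ≡⟨ cong (mergeMap v w) (unmerge-↑ʳ j) ⟩
    mergeMap v w (n ↑ʳ punchIn w j)        ≡⟨ mergeMap-≢w (punchIn w j) (punchInᵢ≢i w j ∘ sym) ⟩
    n ↑ʳ punchOut (punchInᵢ≢i w j ∘ sym)   ≡⟨ cong (n ↑ʳ_) (punchOut-punchIn w) ⟩
    n ↑ʳ j                                 ∎

  unmerge-injective : ∀ {a b} → unmerge a ≡ unmerge b → a ≡ b
  unmerge-injective {a} {b} e =
    trans (sym (mergeMap-unmerge a)) (trans (cong (mergeMap v w) e) (mergeMap-unmerge b))

  unmerge-≢w : ∀ a → unmerge a ≢ n ↑ʳ w
  unmerge-≢w a with splitView n a
  ... | inˡ a₀ = ↑ˡ≢↑ʳ n a₀ w ∘ trans (sym (unmerge-↑ˡ a₀))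
  ... | inʳ j  = punchInᵢ≢i w j ∘ ↑ʳ-injective n _ _ ∘ trans (sym (unmerge-↑ʳ j))

  unmerge-mergeMap : ∀ y → y ≢ n ↑ʳ w → unmerge (mergeMap v w y) ≡ y
  unmerge-mergeMap y y≢w with splitView n y
  ... | inˡ a = trans (cong unmerge (mergeMap-↑ˡ a)) (unmerge-↑ˡ a)
  ... | inʳ b with w ≟ b
  ...   | yes refl = contradiction refl y≢w
  ...   | no w≢b  = begin
    unmerge (mergeMap v w (n ↑ʳ b))   ≡⟨ cong unmerge (mergeMap-≢w b w≢b) ⟩
    unmerge (n ↑ʳ punchOut w≢b)      ≡⟨ unmerge-↑ʳ (punchOut w≢b) ⟩
    n ↑ʳ punchIn w (punchOut w≢b)    ≡⟨ cong (n ↑ʳ_) (punchIn-punchOut w≢b) ⟩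
    n ↑ʳ b                           ∎

module Identification {n m} (G : Graph n) (H : Graph (suc m)) (v : Fin n) (w : Fin (suc m))
  (h : Fin (suc m) → ℤ) (Qᵀh≡0 : ∀ b → Qᵀ H h b ≡ 0ℤ) (h-w≡1 : h w ≡ 1ℤ) where

  private
    U : Graph (n ℕ.+ suc m)
    U = G ∪ H

    U′ : Graph (n ℕ.+ m)
    U′ = identify U v w

    p : Fin (n ℕ.+ suc m) → Fin (n ℕ.+ m)
    p = mergeMap v w

    ι : Fin (n ℕ.+ m) → Fin (n ℕ.+ suc m)
    ι = unmerge v w

    ŵ v̂ : Fin (n ℕ.+ suc m)
    ŵ = n ↑ʳ w
    v̂ = v ↑ˡ suc m

    v̄ : Fin (n ℕ.+ m)
    v̄ = v ↑ˡ m

  push-mergeMap : ∀ (g : Fin (n ℕ.+ suc m) → ℤ) a → push p g a ≡ g (ι a) + δ v̄ a * g ŵ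
  push-mergeMap g a =
    trans (push-fibre (mergeMap-unmerge v w) (unmerge-≢w v w) (unmerge-mergeMap v w) g a)
          (cong (λ t → g (ι a) + δ t a * g ŵ) (mergeMap-w v w))

  Σᴴ : (Fin (n ℕ.+ suc m) → ℤ) → ℤ
  Σᴴ u = Σℤ (λ b → u (n ↑ʳ b))

  Σᴴ-Qᵀ : ∀ z → Σᴴ (Qᵀ U z) ≡ 0ℤ
  Σᴴ-Qᵀ z = trans (Σℤ-cong (Qᵀ-∪ʳ G H z)) (Σℤ-Qᵀ H (λ b → z (n ↑ʳ b)))

  Σᴴ-push : ∀ u → Σᴴ u ≡ u ŵ + Σℤ (λ j → push p u (n ↑ʳ j))
  Σᴴ-push u = trans (Σℤ-punchIn w (λ b → u (n ↑ʳ b)))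
                    (cong (_+_ (u ŵ)) (Σℤ-cong (sym ∘ push-off-w)))
    where
      push-off-w : ∀ j → push p u (n ↑ʳ j) ≡ u (n ↑ʳ punchIn w j)
      push-off-w j = begin
        push p u (n ↑ʳ j)                       ≡⟨ push-mergeMap u (n ↑ʳ j) ⟩
        u (ι (n ↑ʳ j)) + δ v̄ (n ↑ʳ j) * u ŵ
          ≡⟨ cong₂ (λ y d → u y + d * u ŵ) (unmerge-↑ʳ v w j) (δ-≢ (↑ˡ≢↑ʳ n v j)) ⟩
        u (n ↑ʳ punchIn w j) + 0ℤ               ≡⟨ ℤP.+-identityʳ _ ⟩
        u (n ↑ʳ punchIn w j)                    ∎

  push-Σᴴ-injective : ∀ u → (∀ a → push p u a ≡ 0ℤ) → Σᴴ u ≡ 0ℤ → ∀ y → u y ≡ 0ℤ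
  push-Σᴴ-injective u push-u≡0 Σᴴu≡0 = u≡0
    where
      uŵ≡0 : u ŵ ≡ 0ℤ
      uŵ≡0 = begin
        u ŵ                                   ≡⟨ ℤP.+-identityʳ (u ŵ) ⟨
        u ŵ + 0ℤ                              ≡⟨ cong (_+_ (u ŵ)) (Σℤ-zero (push-u≡0 ∘ (n ↑ʳ_))) ⟨
        u ŵ + Σℤ (λ j → push p u (n ↑ʳ j))    ≡⟨ trans (sym (Σᴴ-push u)) Σᴴu≡0 ⟩
        0ℤ                                    ∎
      u≡0 : ∀ y → u y ≡ 0ℤ
      u≡0 y with y ≟ ŵ
      ... | yes refl = uŵ≡0
      ... | no y≢ŵ  = begin
        u y                              ≡⟨ cong u (unmerge-mergeMap v w y y≢ŵ) ⟨
        u (ι (p y))                      ≡⟨ ℤP.+-identityʳ _ ⟨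
        u (ι (p y)) + 0ℤ                 ≡⟨ cong (_+_ (u (ι (p y)))) (ℤP.*-zeroʳ (δ v̄ (p y))) ⟨
        u (ι (p y)) + δ v̄ (p y) * 0ℤ     ≡⟨ cong (λ t → u (ι (p y)) + δ v̄ (p y) * t) uŵ≡0 ⟨
        u (ι (p y)) + δ v̄ (p y) * u ŵ    ≡⟨ push-mergeMap u (p y) ⟨
        push p u (p y)                   ≡⟨ push-u≡0 (p y) ⟩
        0ℤ                               ∎

  Qᵀ-factors-through-merge : ∀ z → ∃[ z′ ] Qᵀ U z ≗ Qᵀ U (z′ ∘ p)
  Qᵀ-factors-through-merge z = z̃ ∘ ι , λ i → trans (Qᵀz≡Qᵀz̃ i) (Qᵀ-cong U z̃≗z̃∘ι∘p i)
    where
      ĥ : Fin (n ℕ.+ suc m) → ℤ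
      ĥ = (λ _ → 0ℤ) ++ h
      c : ℤ
      c = z v̂ - z ŵ
      z̃ : Fin (n ℕ.+ suc m) → ℤ
      z̃ y = z y + c * ĥ y
      Qᵀĥ≡0 : ∀ i → Qᵀ U ĥ i ≡ 0ℤ
      Qᵀĥ≡0 = Qᵀ-∪-++ G H (Qᵀ-zero G) Qᵀh≡0
      Qᵀz≡Qᵀz̃ : Qᵀ U z ≗ Qᵀ U z̃
      Qᵀz≡Qᵀz̃ i = sym (begin
        Qᵀ U z̃ i                            ≡⟨ Qᵀ-+ U z (λ y → c * ĥ y) i ⟩
        Qᵀ U z i + Qᵀ U (λ y → c * ĥ y) i   ≡⟨ cong (_+_ (Qᵀ U z i)) (Qᵀ-* U c ĥ i) ⟩
        Qᵀ U z i + c * Qᵀ U ĥ i             ≡⟨ cong (λ t → Qᵀ U z i + c * t) (Qᵀĥ≡0 i) ⟩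
        Qᵀ U z i + c * 0ℤ                   ≡⟨ cong (_+_ (Qᵀ U z i)) (ℤP.*-zeroʳ c) ⟩
        Qᵀ U z i + 0ℤ                       ≡⟨ ℤP.+-identityʳ _ ⟩
        Qᵀ U z i                            ∎)
      z̃ŵ≡z̃v̂ : z̃ ŵ ≡ z̃ v̂
      z̃ŵ≡z̃v̂ = begin
        z ŵ + c * ĥ ŵ    ≡⟨ cong (λ t → z ŵ + c * t) (lookup-++ʳ {m = n} (λ _ → 0ℤ) h w) ⟩
        z ŵ + c * h w    ≡⟨ cong (λ t → z ŵ + c * t) h-w≡1 ⟩
        z ŵ + c * 1ℤ     ≡⟨ shift (z ŵ) (z v̂) ⟩
        z v̂ + c * 0ℤ     ≡⟨ cong (λ t → z v̂ + c * t) (lookup-++ˡ {n = suc m} (λ _ → 0ℤ) h v) ⟨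
        z v̂ + c * ĥ v̂    ∎
        where
          shift : ∀ a b → a + (b - a) * 1ℤ ≡ b + (b - a) * 0ℤ
          shift = solve-∀
      ι∘p[ŵ]≡v̂ : ι (p ŵ) ≡ v̂
      ι∘p[ŵ]≡v̂ = trans (cong ι (mergeMap-w v w)) (unmerge-↑ˡ v w v)
      z̃≗z̃∘ι∘p : z̃ ≗ z̃ ∘ ι ∘ p
      z̃≗z̃∘ι∘p y with y ≟ ŵ
      ... | yes refl = trans z̃ŵ≡z̃v̂ (cong z̃ (sym ι∘p[ŵ]≡v̂))
      ... | no y≢ŵ  = cong z̃ (sym (unmerge-mergeMap v w y y≢ŵ))

  push-Qᵀ-InImQᵀ : ∀ z → InImQᵀ U′ (push p (Qᵀ U z))
  push-Qᵀ-InImQᵀ z with Qᵀ-factors-through-merge z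
  ... | z′ , Qᵀz≗Qᵀz′p = z′ , λ a → trans (push-cong p Qᵀz≗Qᵀz′p a) (push-Qᵀ U p z′ a)

  InImQᵀ-reflect : ∀ {u} → InImQᵀ U′ (push p u) → Σᴴ u ≡ 0ℤ → InImQᵀ U u
  InImQᵀ-reflect {u} (z′ , push-u≗Qᵀz′) Σᴴu≡0 =
    z′ ∘ p , λ y → ℤP.i-j≡0⇒i≡j _ _ (push-Σᴴ-injective r push-r≡0 Σᴴr≡0 y)
    where
      r : Fin (n ℕ.+ suc m) → ℤ
      r y = u y - Qᵀ U (z′ ∘ p) y
      push-r≡0 : ∀ a → push p r a ≡ 0ℤ
      push-r≡0 a = begin
        push p r a                                ≡⟨ push-sub p u (Qᵀ U (z′ ∘ p)) a ⟩
        push p u a - push p (Qᵀ U (z′ ∘ p)) a     ≡⟨ cong₂ _-_ (push-u≗Qᵀz′ a) (push-Qᵀ U p z′ a) ⟩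
        Qᵀ U′ z′ a - Qᵀ U′ z′ a                   ≡⟨ ℤP.+-inverseʳ (Qᵀ U′ z′ a) ⟩
        0ℤ                                        ∎
      Σᴴr≡0 : Σᴴ r ≡ 0ℤ
      Σᴴr≡0 = trans (Σℤ-sub (λ b → u (n ↑ʳ b)) (λ b → Qᵀ U (z′ ∘ p) (n ↑ʳ b)))
                    (cong₂ _-_ Σᴴu≡0 (Σᴴ-Qᵀ (z′ ∘ p)))

  push-≈ : ∀ {x y} → x ≈[ U ] y → push p x ≈[ U′ ] push p y
  push-≈ {x} {y} (z , x-y≗Qᵀz) = InImQᵀ-resp-≗ U′
    (λ a → trans (sym (push-sub p x y a)) (push-cong p x-y≗Qᵀz a))
    (push-Qᵀ-InImQᵀ z)

  Σᴴ-≈ : ∀ {x y} → x ≈[ U ] y → Σᴴ x ≡ Σᴴ y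
  Σᴴ-≈ {x} {y} (z , x-y≗Qᵀz) = ℤP.i-j≡0⇒i≡j _ _ (begin
    Σᴴ x - Σᴴ y                       ≡⟨ Σℤ-sub (λ b → x (n ↑ʳ b)) (λ b → y (n ↑ʳ b)) ⟨
    Σᴴ (λ i → x i - y i)              ≡⟨ Σℤ-cong (x-y≗Qᵀz ∘ (n ↑ʳ_)) ⟩
    Σᴴ (Qᵀ U z)                       ≡⟨ Σᴴ-Qᵀ z ⟩
    0ℤ                                ∎)

  ≈-reflect : ∀ {x y} → push p x ≈[ U′ ] push p y → Σᴴ x ≡ Σᴴ y → x ≈[ U ] y
  ≈-reflect {x} {y} push-x≈push-y Σᴴx≡Σᴴy = InImQᵀ-reflect
    (InImQᵀ-resp-≗ U′ (push-sub p x y) push-x≈push-y)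
    (trans (Σℤ-sub (λ b → x (n ↑ʳ b)) (λ b → y (n ↑ʳ b))) (ℤP.i≡j⇒i-j≡0 Σᴴx≡Σᴴy))

  deficit : (Fin (n ℕ.+ m) → ℤ) → ℤ → ℤ
  deficit x c = c - Σℤ (λ j → x (n ↑ʳ j))

  -- x ∘ p away from w, plus a multiple of e_w − e_v (invisible to push) fixing the H-sum.
  lift : (Fin (n ℕ.+ m) → ℤ) → ℤ → Fin (n ℕ.+ suc m) → ℤ
  lift x c y = (if ⌊ y ≟ ŵ ⌋ then 0ℤ else x (p y)) + deficit x c * (δ ŵ y - δ v̂ y)

  lift-ŵ : ∀ x c → lift x c ŵ ≡ deficit x c
  lift-ŵ x c with ŵ ≟ ŵ
  ... | no ŵ≢ŵ = contradiction refl ŵ≢ŵ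
  ... | yes _   = trans (cong (λ d → 0ℤ + deficit x c * (1ℤ - d)) (δ-≢ (↑ˡ≢↑ʳ n v w)))
                        (unit (deficit x c))
    where
      unit : ∀ t → 0ℤ + t * (1ℤ - 0ℤ) ≡ t
      unit = solve-∀

  lift-ι : ∀ x c a → lift x c (ι a) ≡ x a + deficit x c * (0ℤ - δ v̄ a)
  lift-ι x c a with ι a ≟ ŵ
  ... | yes ιa≡ŵ = contradiction ιa≡ŵ (unmerge-≢w v w a)
  ... | no _     = cong₂ (λ s d → s + deficit x c * d) (cong x (mergeMap-unmerge v w a))
                         (cong₂ _-_ (δ-≢ (unmerge-≢w v w a ∘ sym)) δv̂ιa≡δv̄a)
    where
      δv̂ιa≡δv̄a : δ v̂ (ι a) ≡ δ v̄ a
      δv̂ιa≡δv̄a = trans (cong (λ t → δ t (ι a)) (sym (unmerge-↑ˡ v w v)))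
                        (δ-injective (unmerge-injective v w) v̄ a)

  push-lift : ∀ x c → push p (lift x c) ≗ x
  push-lift x c a = begin
    push p (lift x c) a                          ≡⟨ push-mergeMap (lift x c) a ⟩
    lift x c (ι a) + δ v̄ a * lift x c ŵ
      ≡⟨ cong₂ (λ s t → s + δ v̄ a * t) (lift-ι x c a) (lift-ŵ x c) ⟩
    x a + t * (0ℤ - δ v̄ a) + δ v̄ a * t           ≡⟨ cancel (x a) t (δ v̄ a) ⟩
    x a                                          ∎
    where
      t : ℤ
      t = deficit x c
      cancel : ∀ x t d → x + t * (0ℤ - d) + d * t ≡ x
      cancel = solve-∀

  Σᴴ-lift : ∀ x c → Σᴴ (lift x c) ≡ c
  Σᴴ-lift x c = begin
    Σᴴ (lift x c)                                        ≡⟨ Σᴴ-push (lift x c) ⟩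
    lift x c ŵ + Σℤ (λ j → push p (lift x c) (n ↑ʳ j))
      ≡⟨ cong₂ _+_ (lift-ŵ x c) (Σℤ-cong (push-lift x c ∘ (n ↑ʳ_))) ⟩
    c - Σℤ (λ j → x (n ↑ʳ j)) + Σℤ (λ j → x (n ↑ʳ j))    ≡⟨ cancel c (Σℤ (λ j → x (n ↑ʳ j))) ⟩
    c                                                    ∎
    where
      cancel : ∀ c s → c - s + s ≡ c
      cancel = solve-∀

  push-torsion : ∀ {x} → IsTorsion U x → IsTorsion U′ (push p x)
  push-torsion {x} (k , z , kx≗Qᵀz) = k , InImQᵀ-resp-≗ U′
    (λ a → trans (sym (push-* p (+ suc k) x a)) (push-cong p kx≗Qᵀz a))
    (push-Qᵀ-InImQᵀ z)

  Σᴴ-torsion : ∀ {x} → IsTorsion U x → Σᴴ x ≡ 0ℤ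
  Σᴴ-torsion {x} (k , z , kx≗Qᵀz) = ℤP.*-cancelˡ-≡ (+ suc k) (Σᴴ x) 0ℤ (begin
    + suc k * Σᴴ x                    ≡⟨ Σℤ-* (+ suc k) (λ b → x (n ↑ʳ b)) ⟨
    Σᴴ (λ i → + suc k * x i)          ≡⟨ Σℤ-cong (kx≗Qᵀz ∘ (n ↑ʳ_)) ⟩
    Σᴴ (Qᵀ U z)                       ≡⟨ Σᴴ-Qᵀ z ⟩
    0ℤ                                ≡⟨ ℤP.*-zeroʳ (+ suc k) ⟨
    + suc k * 0ℤ                      ∎)

  lift-torsion : ∀ {x} → IsTorsion U′ x → IsTorsion U (lift x 0ℤ)
  lift-torsion {x} (k , InImQᵀ-kx) = k , InImQᵀ-reflect
    (InImQᵀ-resp-≗ U′ (λ a → trans (push-* p (+ suc k) (lift x 0ℤ) a)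
                                    (cong (+ suc k *_) (push-lift x 0ℤ a))) InImQᵀ-kx)
    (trans (Σℤ-* (+ suc k) (λ b → lift x 0ℤ (n ↑ʳ b)))
           (trans (cong (+ suc k *_) (Σᴴ-lift x 0ℤ)) (ℤP.*-zeroʳ (+ suc k))))

  𝒦-iso : 𝒦 U ≅ (𝒦 U′ ⊕ ℤ-rawGroup)
  𝒦-iso = (λ x → push p x , Σᴴ x) , record
    { isGroupMonomorphism = record
      { isGroupHomomorphism = record
        { isMonoidHomomorphism = record
          { isMagmaHomomorphism = record
            { isRelHomomorphism = record
              { cong = λ {x} {y} x≈y → push-≈ {x} {y} x≈y , Σᴴ-≈ {x} {y} x≈y }
            ; homo = λ x y → ≗⇒≈ U′ (push-+ p x y)
                           , Σℤ-+ (λ b → x (n ↑ʳ b)) (λ b → y (n ↑ʳ b))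
            }
          ; ε-homo = ≗⇒≈ U′ (push-zero p) , Σℤ-zero {suc m} (λ _ → refl)
          }
        ; ⁻¹-homo = λ x → ≗⇒≈ U′ (push-neg p x) , Σℤ-neg (λ b → x (n ↑ʳ b))
        }
      ; injective = λ (push≈ , Σᴴ≡) → ≈-reflect push≈ Σᴴ≡
      }
    ; surjective = λ (x , c) → lift x c , λ {z} z≈lift →
        ≈-trans U′ {push p z} {push p (lift x c)} (push-≈ {z} z≈lift) (≗⇒≈ U′ (push-lift x c))
        , trans (Σᴴ-≈ {z} z≈lift) (Σᴴ-lift x c)
    }

  K-iso : K U ≅ K U′
  K-iso = (λ (x , x-tor) → push p x , push-torsion x-tor) , record
    { isGroupMonomorphism = record
      { isGroupHomomorphism = record
        { isMonoidHomomorphism = record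
          { isMagmaHomomorphism = record
            { isRelHomomorphism = record { cong = λ {x} {y} → push-≈ {proj₁ x} {proj₁ y} }
            ; homo = λ x y → ≗⇒≈ U′ (push-+ p (proj₁ x) (proj₁ y))
            }
          ; ε-homo = ≗⇒≈ U′ (push-zero p)
          }
        ; ⁻¹-homo = λ x → ≗⇒≈ U′ (push-neg p (proj₁ x))
        }
      ; injective = λ {(x , x-tor)} {(y , y-tor)} push≈ →
          ≈-reflect push≈ (trans (Σᴴ-torsion x-tor) (sym (Σᴴ-torsion y-tor)))
      }
    ; surjective = λ (x , x-tor) → (lift x 0ℤ , lift-torsion x-tor) , λ {(z , _)} z≈lift →
        ≈-trans U′ {push p z} {push p (lift x 0ℤ)} (push-≈ {z} z≈lift) (≗⇒≈ U′ (push-lift x 0ℤ))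
    }

-- Only a kernel vector of Qᵀ_H with value 1 at w is used; strong connectivity merely
-- guarantees that the activity vector exists.
proposition7p2 : ∀ {n m} (G : Graph n) (H : Graph (suc m)) (v : Fin n) (w : Fin (suc m)) →
    StronglyConnected G → StronglyConnected H → SimpleVertex H w →
    (𝒦 (G ∪ H) ≅ (𝒦 (identify (G ∪ H) v w) ⊕ ℤ-rawGroup))
    × (K (G ∪ H) ≅ K (identify (G ∪ H) v w))
proposition7p2 G H v w _ _ (h , (_ , _ , Qᵀh≡0) , h-w≡1) = 𝒦-iso , K-iso
  where open Identification G H v w (λ j → + h j) Qᵀh≡0 (cong +_ h-w≡1)
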